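{- Let $\{\{X_s:s\in\omega^{n+1}\}:n\in\omega\}$ be a family such that for every $n\in\omega$, $\{X_s:s\in\omega^{n+1}\}$ is a partition of $\omega$ into infinite sets, and such that $\bigcap_{i\in F}X_{s_i}$ is infinite for every finite $F\subseteq\omega$ and every choice of $s_i\in\omega^{i+1}$, $i\in F$, and let $\mathrm{Fin}'_\omega$ be the ideal on $\omega$ defined from this family as in the context. Then $\mathrm{Fin}'_\omega\sqsubseteq\mathrm{Fin}_\omega$.
   Context: An ideal on a countably infinite set $X$ is a family of subsets of $X$ closed under subsets and finite unions, not containing $X$ and containing all finite subsets of $X$. $\mathrm{Fin}$ is the ideal of finite subsets of $\omega$. For $n\ge1$ the ideal $\mathrm{Fin}^n$ on $\omega^n$ is defined by $\mathrm{Fin}^1=\mathrm{Fin}$ and: $A\subseteq\omega^{n+1}$ is in $\mathrm{Fin}^{n+1}$ iff $\{i\in\omega:\{x\in\omega^n:(i,x)\in A\}\notin\mathrm{Fin}^n\}$ is finite. For $n\in\omega$, $\mathrm{Fin}^{n+2}(\{X_s:s\in\omega^{n+1}\})$ is the family of all $A\subseteq\omega$ with $\{s\in\omega^{n+1}:A\cap X_s\text{ infinite}\}\in\mathrm{Fin}^{n+1}$; $\mathrm{Fin}'_\omega$ is the ideal on $\omega$ generated by $\bigcup_{n\in\omega}\mathrm{Fin}^{n+2}(\{X_s:s\in\omega^{n+1}\})$ (sets contained in finite unions of members). $\mathrm{Fin}_\omega$ is the ideal on $\sum_{n\ge1}\omega^n=\{(n,x):n\ge1,x\in\omega^n\}$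 defined as follows: for $1\le i\le j$ let $\pi_{i,j}:\omega^j\to\omega^i$, $\pi_{i,j}(x_0,\dots,x_{j-1})=(x_{j-i},\dots,x_{j-1})$; then $M\in\mathrm{Fin}_\omega$ iff there are $i\ge1$ and $P\subseteq\omega^i$ with $\omega^i\setminus P\in\mathrm{Fin}^i$ such that $M\cap\{(j,x):j\ge i,\ \pi_{i,j}(x)\in P\}=\emptyset$. For ideals $\mathcal{I},\mathcal{J}$, $\mathcal{I}\sqsubseteq\mathcal{J}$ means there is a bijection $f:\mathrm{dom}(\mathcal{J})\to\mathrm{dom}(\mathcal{I})$ with $f^{ -1}[A]\in\mathcal{J}$ for all $A\in\mathcal{I}$. -}

module Defs where

open import Data.Nat using (ℕ; zero; suc; _<_)
open import Data.Vec using (Vec; []; _∷_)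
open import Data.List using (List)
open import Data.List.Relation.Unary.All using (All)
open import Data.List.Relation.Unary.Any using (Any)
open import Data.Product using (Σ; _×_; ∃; proj₁; proj₂)
open import Data.Empty using (⊥)
open import Relation.Nullary using (¬_)
open import Relation.Binary.PropositionalEquality using (_≡_)
open import Function.Bundles using (_⤖_; Bijection)

-- subsets of ω are predicates ℕ → Set
-- a subset of ω is finite iff it is bounded
FinSet : (ℕ → Set) → Set
FinSet A = Σ ℕ λ N → ∀ k → A k → k < N

Infinite : (ℕ → Set) → Set
Infinite A = ¬ FinSet A

-- FinN n is the ideal Fin^(n+1) on ω^(n+1) = Vec ℕ (suc n);
-- a pair (i , x) is the vector i ∷ x
FinN : (n : ℕ) → (Vec ℕ (suc n) → Set) → Set
FinN zero A = FinSet (λ i → A (i ∷ []))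
FinN (suc n) A = FinSet (λ i → ¬ FinN n (λ x → A (i ∷ x)))

-- the domain Σ_{n≥1} ω^n : (m , x) stands for (m+1 , x) with x ∈ ω^(m+1)
Dom : Set
Dom = Σ ℕ λ m → Vec ℕ (suc m)

data Suffix {k : ℕ} (y : Vec ℕ k) : {m : ℕ} → Vec ℕ m → Set where
  here  : Suffix y y
  there : ∀ {m} (a : ℕ) {x : Vec ℕ m} → Suffix y x → Suffix y (a ∷ x)

-- Fin_ω : with i = k+1, M ∈ Fin_ω iff some P ⊆ ω^i with ω^i \ P ∈ Fin^i
-- has M disjoint from {(j,x) : j ≥ i, π_{i,j}(x) ∈ P}
FinOmega : (Dom → Set) → Set₁
FinOmega M = Σ ℕ λ k → Σ (Vec ℕ (suc k) → Set) λ P →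
  FinN k (λ y → ¬ P y) ×
  (∀ m (x : Vec ℕ (suc m)) → M (m Data.Product., x) → ∀ y → P y → Suffix y x → ⊥)

Family : Set₁
Family = (n : ℕ) → Vec ℕ (suc n) → ℕ → Set

FinN2 : Family → ℕ → (ℕ → Set) → Set
FinN2 X n A = FinN n (λ s → Infinite (λ k → A k × X n s k))

FinOmega' : Family → (ℕ → Set) → Set₁
FinOmega' X A = Σ (List (Σ ℕ λ n → ℕ → Set)) λ L →
  All (λ p → FinN2 X (proj₁ p) (proj₂ p)) L ×
  (∀ k → A k → Any (λ p → proj₂ p k) L)

IsPartitionInf : Family → ℕ → Set
IsPartitionInf X n =
  (∀ s → Infinite (X n s)) ×
  (∀ k → ∃ λ s → X n s k) ×
  (∀ s t k → X n s k → X n t k → s ≡ t)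

IntersectionsInfinite : Family → Set
IntersectionsInfinite X =
  (F : List ℕ) (c : (i : ℕ) → Vec ℕ (suc i)) →
  Infinite (λ k → All (λ i → X i (c i) k) F)

_⊑_ : ((ℕ → Set) → Set₁) → ((Dom → Set) → Set₁) → Set₁
I ⊑ J = Σ (Dom ⤖ ℕ) λ f → ∀ A → I A → J (λ d → A (Bijection.to f d))

{-# OPTIONS --safe #-}
module Submission where

-- Enumerate the vectors of length at least 2 and build, back and forth, a
-- bijection F from Σ_{n≥1} ω^n onto ω such that F x lies in X_{init w} and
-- above last w for every suffix w of x of length at least 2: these
-- constraints describe an infinite set, an intersection of finitely many X_s
-- minus a finite set. If A ∩ X_s is infinite only for a Fin^{n+1}-small set of
-- s ∈ ω^{n+1}, then the w ∈ ω^{n+2} such that A meets X_{init w} above last w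
-- form a Fin^{n+2}-small set, and F sends no vector with a suffix outside it
-- into A. So F pulls the generators of Fin'_ω back into the ideal Fin_ω.

open import Defs
open import Level using (0ℓ)
open import Axiom.ExcludedMiddle using (ExcludedMiddle)
open import Axiom.DoubleNegationElimination using (em⇒dne)
open import Data.Nat using (ℕ; zero; suc; _+_; _≤_; _<_; _≤′_; ≤′-refl; ≤′-step; z≤n; s≤s; _⊔_; _≤?_; _<?_; _≟_)
open import Data.Nat.Properties
open import Data.Product using (Σ; _×_; _,_; proj₁; proj₂; ∃; uncurry)
open import Data.Sum using (_⊎_; inj₁; inj₂)
open import Data.Vec using (Vec; []; _∷_; [_]; head; uncons; init; last; replicate)
open import Data.List using (List; []; _∷_; upTo)
open import Data.List.Relation.Unary.All using (All; []; _∷_)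
import Data.List.Relation.Unary.All as All
open import Data.List.Relation.Unary.Any using (Any; here; there)
open import Data.List.Membership.Propositional using (_∈_; _∉_)
open import Data.List.Membership.Propositional.Properties using (∈-upTo⁺)
open import Data.List.Membership.DecPropositional _≟_ using (_∈?_)
open import Data.List.Relation.Binary.Subset.Propositional using (_⊆_)
open import Data.List.Extrema.Nat using (max; xs≤max)
open import Data.Empty using (⊥)
open import Data.Unit using (⊤; tt)
open import Relation.Nullary using (¬_; yes; no; contradiction)
open import Relation.Binary using (tri<; tri≈; tri>)
open import Relation.Binary.PropositionalEquality using (_≡_; _≢_; refl; sym; trans; cong; subst)
open import Function.Base using (id; case_of_)
open import Function.Bundles using (_↔_; _⤖_; Inverse; Bijection; mk↔ₛ′; mk⤖)
open import Function.Definitions using (Injective; Surjective)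
open import Function.Properties.Inverse using (↔-refl; ↔⇒⤖)
open import Function.Construct.Composition using (_↔-∘_; _⤖-∘_)
open import Data.Product.Function.NonDependent.Propositional using (_×-↔_)
open import Data.Product.Function.Dependent.Propositional using (Σ-↔)

triangle : ℕ → ℕ
triangle zero    = zero
triangle (suc n) = suc n + triangle n

cantorPair : ℕ × ℕ → ℕ
cantorPair (a , b) = triangle (a + b) + a

cantorSucc : ℕ × ℕ → ℕ × ℕ
cantorSucc (a , zero)  = 0 , suc a
cantorSucc (a , suc b) = suc a , b

cantorUnpair : ℕ → ℕ × ℕ
cantorUnpair zero    = 0 , 0
cantorUnpair (suc n) = cantorSucc (cantorUnpair n)

cantorPair-succ : ∀ p → cantorPair (cantorSucc p) ≡ suc (cantorPair p)
cantorPair-succ (a , zero)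
  rewrite +-identityʳ a | +-identityʳ (suc a + triangle a) = cong suc (+-comm a (triangle a))
cantorPair-succ (a , suc b) rewrite +-suc a b = +-suc (triangle (suc (a + b))) a

cantorPair-unpair : ∀ n → cantorPair (cantorUnpair n) ≡ n
cantorPair-unpair zero    = refl
cantorPair-unpair (suc n) = trans (cantorPair-succ (cantorUnpair n)) (cong suc (cantorPair-unpair n))

cantorUnpair-pair′ : ∀ n p → cantorPair p ≡ n → cantorUnpair n ≡ p
cantorUnpair-pair′ zero    (zero , zero)  eq = refl
cantorUnpair-pair′ (suc n) (zero , suc b) eq =
  cong cantorSucc (cantorUnpair-pair′ n (b , zero) (suc-injective (trans (sym (cantorPair-succ (b , zero))) eq)))
cantorUnpair-pair′ (suc n) (suc a , b)    eq =
  cong cantorSucc (cantorUnpair-pair′ n (a , suc b) (suc-injective (trans (sym (cantorPair-succ (a , suc b))) eq)))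

cantorUnpair-pair : ∀ p → cantorUnpair (cantorPair p) ≡ p
cantorUnpair-pair p = cantorUnpair-pair′ (cantorPair p) p refl

ℕ×ℕ↔ℕ : (ℕ × ℕ) ↔ ℕ
ℕ×ℕ↔ℕ = mk↔ₛ′ cantorPair cantorUnpair cantorPair-unpair cantorUnpair-pair

Vec↔ℕ : ∀ m → Vec ℕ (suc m) ↔ ℕ
Vec↔ℕ zero    = mk↔ₛ′ head [_] (λ _ → refl) (λ { (x ∷ []) → refl })
Vec↔ℕ (suc m) = ℕ×ℕ↔ℕ ↔-∘ ((↔-refl ×-↔ Vec↔ℕ m) ↔-∘ uncons↔)
  where
  uncons↔ : Vec ℕ (suc (suc m)) ↔ (ℕ × Vec ℕ (suc m))
  uncons↔ = mk↔ₛ′ uncons (uncurry _∷_) (λ _ → refl) (λ { (x ∷ xs) → refl })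

LongVec : Set
LongVec = Σ ℕ λ m → Vec ℕ (suc (suc m))

LongVec↔ℕ : LongVec ↔ ℕ
LongVec↔ℕ = ℕ×ℕ↔ℕ ↔-∘ Σ-↔ ↔-refl (Vec↔ℕ (suc _))

Dom↔ℕ⊎ℕ : Dom ↔ (ℕ ⊎ ℕ)
Dom↔ℕ⊎ℕ = mk↔ₛ′ split merge split-merge merge-split
  where
  open Inverse LongVec↔ℕ
  split : Dom → ℕ ⊎ ℕ
  split (zero , j ∷ []) = inj₁ j
  split (suc m , x)     = inj₂ (to (m , x))
  merge : ℕ ⊎ ℕ → Dom
  merge (inj₁ j) = zero , j ∷ []
  merge (inj₂ t) = suc (proj₁ (from t)) , proj₂ (from t)
  split-merge : ∀ a → split (merge a) ≡ a
  split-merge (inj₁ j) = refl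
  split-merge (inj₂ t) = cong inj₂ (strictlyInverseˡ t)
  merge-split : ∀ d → merge (split d) ≡ d
  merge-split (zero , j ∷ []) = refl
  merge-split (suc m , x)     = cong (λ (m , x) → suc m , x) (strictlyInverseʳ (m , x))

Unbounded : (ℕ → Set) → Set
Unbounded A = ∀ N → Σ ℕ λ k → A k × N ≤ k

infinite⇒unbounded : ExcludedMiddle 0ℓ → ∀ {A} → Infinite A → Unbounded A
infinite⇒unbounded em {A} infinite N with em {Σ ℕ λ k → A k × N ≤ k}
... | yes above = above
... | no ¬above = contradiction (N , bounded) infinite
  where
  bounded : ∀ k → A k → k < N
  bounded k a with k <? N
  ... | yes k<N = k<N
  ... | no k≮N  = contradiction (k , a , ≮⇒≥ k≮N) ¬above

distinct-on-<⇒injective : ∀ {A : Set} {f : ℕ → A} → (∀ {i j} → i < j → f i ≢ f j) → ∀ {i j} → f i ≡ f j → i ≡ j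
distinct-on-<⇒injective distinct {i} {j} eq with <-cmp i j
... | tri< i<j _ _ = contradiction eq (distinct i<j)
... | tri≈ _ i≡j _ = i≡j
... | tri> _ _ j<i = contradiction (sym eq) (distinct j<i)

>max⇒∉ : ∀ {k u} → max 0 u < k → k ∉ u
>max⇒∉ {u = u} max<k k∈u = <⇒≱ max<k (All.lookup (xs≤max 0 u) k∈u)

-- Stage t gives inj₂ t a value in P t above all values used so far, then gives
-- inj₁ t the value t itself unless it is already taken; so t is in the range.
module Interleaving (P : ℕ → ℕ → Set) (unbounded : ∀ t → Unbounded (P t)) where

  avoid : ℕ → List ℕ → ℕ
  avoid t u with t ∈? u
  ... | yes _ = suc (max 0 u)
  ... | no _  = t

  avoid-∉ : ∀ t u → avoid t u ∉ u
  avoid-∉ t u with t ∈? u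
  ... | yes _   = >max⇒∉ ≤-refl
  ... | no t∉u  = t∉u

  ∈-avoid : ∀ t u → t ∈ avoid t u ∷ u
  ∈-avoid t u with t ∈? u
  ... | yes t∈u = there t∈u
  ... | no _    = here refl

  used : ℕ → List ℕ
  hit : ℕ → ℕ
  cover : ℕ → ℕ

  used zero    = []
  used (suc t) = cover t ∷ hit t ∷ used t

  hit t = proj₁ (unbounded t (suc (max 0 (used t))))

  cover t = avoid t (hit t ∷ used t)

  hit-∉ : ∀ t → hit t ∉ used t
  hit-∉ t = >max⇒∉ (proj₂ (proj₂ (unbounded t (suc (max 0 (used t))))))

  cover-∉ : ∀ t → cover t ∉ hit t ∷ used t
  cover-∉ t = avoid-∉ t (hit t ∷ used t)

  used-mono : ∀ {t t′} → t ≤′ t′ → used t ⊆ used t′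
  used-mono ≤′-refl       = id
  used-mono (≤′-step t≤t′) k∈u = there (there (used-mono t≤t′ k∈u))

  hit-∈ : ∀ {t t′} → t < t′ → hit t ∈ used t′
  hit-∈ t<t′ = used-mono (≤⇒≤′ t<t′) (there (here refl))

  cover-∈ : ∀ {t t′} → t < t′ → cover t ∈ used t′
  cover-∈ t<t′ = used-mono (≤⇒≤′ t<t′) (here refl)

  hit-injective : ∀ {t t′} → hit t ≡ hit t′ → t ≡ t′
  hit-injective = distinct-on-<⇒injective λ t<t′ eq → hit-∉ _ (subst (_∈ used _) eq (hit-∈ t<t′))

  cover-injective : ∀ {t t′} → cover t ≡ cover t′ → t ≡ t′
  cover-injective = distinct-on-<⇒injective λ t<t′ eq → cover-∉ _ (there (subst (_∈ used _) eq (cover-∈ t<t′)))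

  hit≢cover : ∀ t t′ → hit t ≢ cover t′
  hit≢cover t t′ eq with ≤-<-connex t t′
  ... | inj₂ t′<t = hit-∉ t (subst (_∈ used t) (sym eq) (cover-∈ t′<t))
  ... | inj₁ t≤t′ with m≤n⇒m<n∨m≡n t≤t′
  ...   | inj₁ t<t′ = cover-∉ t′ (there (subst (_∈ used t′) eq (hit-∈ t<t′)))
  ...   | inj₂ refl = cover-∉ t (here (sym eq))

  interleave : ℕ ⊎ ℕ → ℕ
  interleave (inj₁ t) = cover t
  interleave (inj₂ t) = hit t

  interleave-injective : Injective _≡_ _≡_ interleave
  interleave-injective {inj₁ t} {inj₁ t′} eq = cong inj₁ (cover-injective eq)
  interleave-injective {inj₁ t} {inj₂ t′} eq = contradiction (sym eq) (hit≢cover t′ t)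
  interleave-injective {inj₂ t} {inj₁ t′} eq = contradiction eq (hit≢cover t t′)
  interleave-injective {inj₂ t} {inj₂ t′} eq = cong inj₂ (hit-injective eq)

  used⊆image : ∀ {k} t → k ∈ used t → ∃ λ a → interleave a ≡ k
  used⊆image (suc t) (here refl)         = inj₁ t , refl
  used⊆image (suc t) (there (here refl)) = inj₂ t , refl
  used⊆image (suc t) (there (there k∈u)) = used⊆image t k∈u

  interleave-surjective : Surjective _≡_ _≡_ interleave
  interleave-surjective k with used⊆image (suc k) (∈-avoid k (hit k ∷ used k))
  ... | a , eq = a , λ { refl → eq }

interleaving-bijection : (P : ℕ → ℕ → Set) → (∀ t → Unbounded (P t)) →
  Σ ((ℕ ⊎ ℕ) ⤖ ℕ) λ G → ∀ t → P t (Bijection.to G (inj₂ t))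
interleaving-bijection P unbounded =
  mk⤖ (interleave-injective , interleave-surjective) , λ t → proj₁ (proj₂ (unbounded t _))
  where open Interleaving P unbounded

Suffix-length : ∀ {k m} {w : Vec ℕ k} {x : Vec ℕ m} → Suffix w x → k ≤ m
Suffix-length here          = ≤-refl
Suffix-length (there a w≼x) = m≤n⇒m≤1+n (Suffix-length w≼x)

Suffix-trans : ∀ {k l m} {w : Vec ℕ k} {y : Vec ℕ l} {x : Vec ℕ m} → Suffix w y → Suffix y x → Suffix w x
Suffix-trans w≼y here          = w≼y
Suffix-trans w≼y (there a y≼x) = there a (Suffix-trans w≼y y≼x)

Suffix-tail : ∀ {k m} {w : Vec ℕ k} {a} {x : Vec ℕ m} → k ≤ m → Suffix w (a ∷ x) → Suffix w x
Suffix-tail k≤m here          = contradiction k≤m 1+n≰n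
Suffix-tail k≤m (there a w≼x) = w≼x

Suffix⇒≡ : ∀ {k} {w x : Vec ℕ k} → Suffix w x → w ≡ x
Suffix⇒≡ here          = refl
Suffix⇒≡ (there a w≼x) = contradiction (Suffix-length w≼x) 1+n≰n

Suffix-unique : ∀ {k m} {w w′ : Vec ℕ k} {x : Vec ℕ m} → Suffix w x → Suffix w′ x → w ≡ w′
Suffix-unique here           w′≼x            = sym (Suffix⇒≡ w′≼x)
Suffix-unique (there a w≼x)  here            = Suffix⇒≡ (there a w≼x)
Suffix-unique (there a w≼x)  (there .a w′≼x) = Suffix-unique w≼x w′≼x

suffix : ∀ {m} (x : Vec ℕ m) {k} → k ≤ m → Σ (Vec ℕ k) λ w → Suffix w x
suffix []      z≤n = [] , here
suffix (a ∷ x) k≤m with m≤n⇒m<n∨m≡n k≤m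
... | inj₂ refl      = a ∷ x , here
... | inj₁ (s≤s k≤n) = let w , w≼x = suffix x k≤n in w , there a w≼x

Suffix-last : ∀ {k m} {w : Vec ℕ (suc k)} {x : Vec ℕ (suc m)} → Suffix w x → last w ≡ last x
Suffix-last here                                  = refl
Suffix-last {x = a ∷ []}         (there .a ())
Suffix-last {m = suc m} {x = a ∷ x} (there .a w≼x) = Suffix-last w≼x

HasSuffixIn : ∀ {k m} → (Vec ℕ k → Set) → Vec ℕ m → Set
HasSuffixIn {k} C y = Σ (Vec ℕ k) λ w → Suffix w y × C w

FinN-mono : ∀ n {B C : Vec ℕ (suc n) → Set} → (∀ y → B y → C y) → FinN n C → FinN n B
FinN-mono zero    B⊆C (N , bound) = N , λ k b → bound k (B⊆C _ b)
FinN-mono (suc n) B⊆C (N , bound) = N , λ i ¬finB → bound i (λ finC → ¬finB (FinN-mono n (λ x → B⊆C (i ∷ x)) finC))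

FinN-empty : ∀ n {B : Vec ℕ (suc n) → Set} → (∀ y → ¬ B y) → FinN n B
FinN-empty zero    empty = 0 , λ k b → contradiction b (empty _)
FinN-empty (suc n) empty = 0 , λ i ¬fin → contradiction (FinN-empty n (λ x → empty (i ∷ x))) ¬fin

FinN-∪ : ExcludedMiddle 0ℓ → ∀ n {B C : Vec ℕ (suc n) → Set} → FinN n B → FinN n C → FinN n (λ y → B y ⊎ C y)
FinN-∪ em zero (N₁ , bound₁) (N₂ , bound₂) = N₁ ⊔ N₂ , bound
  where
  bound : ∀ k → _ → k < N₁ ⊔ N₂
  bound k (inj₁ b) = <-≤-trans (bound₁ k b) (m≤m⊔n N₁ N₂)
  bound k (inj₂ c) = <-≤-trans (bound₂ k c) (m≤n⊔m N₁ N₂)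
FinN-∪ em (suc n) {B} {C} (N₁ , bound₁) (N₂ , bound₂) = N₁ ⊔ N₂ , bound
  where
  bound : ∀ i → ¬ FinN n (λ x → B (i ∷ x) ⊎ C (i ∷ x)) → i < N₁ ⊔ N₂
  bound i ¬fin with em {FinN n (λ x → B (i ∷ x))} | em {FinN n (λ x → C (i ∷ x))}
  ... | yes finB | yes finC = contradiction (FinN-∪ em n finB finC) ¬fin
  ... | no ¬finB | _        = <-≤-trans (bound₁ i ¬finB) (m≤m⊔n N₁ N₂)
  ... | yes _    | no ¬finC = <-≤-trans (bound₂ i ¬finC) (m≤n⊔m N₁ N₂)

FinN-lastFibres : ∀ n (H : Vec ℕ (suc n) → ℕ → Set) → FinN n (λ s → ¬ FinSet (H s)) →
  FinN (suc n) (λ w → H (init w) (last w))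
FinN-lastFibres zero    H fin         = fin
FinN-lastFibres (suc n) H (N , bound) =
  N , λ a ¬fin → bound a (λ fin → ¬fin (FinN-lastFibres n (λ s → H (a ∷ s)) fin))

FinN-suffixes : ∀ {k K} → k ≤′ K → (C : Vec ℕ (suc k) → Set) → FinN k C → FinN K (HasSuffixIn C)
FinN-suffixes {k} ≤′-refl C fin =
  FinN-mono k (λ y (w , w≼y , c) → subst C (Suffix⇒≡ w≼y) c) fin
FinN-suffixes {k} (≤′-step {K} k≤K) C fin = 0 , λ a ¬fin → contradiction (FinN-mono K drop-a (FinN-suffixes k≤K C fin)) ¬fin
  where
  drop-a : ∀ {a} y → HasSuffixIn C (a ∷ y) → HasSuffixIn C y
  drop-a y (w , w≼ay , c) = w , Suffix-tail (s≤s (≤′⇒≤ k≤K)) w≼ay , c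

Avoids : ∀ {k} → (Dom → Set) → (Vec ℕ (suc k) → Set) → Set
Avoids M P = ∀ m (x : Vec ℕ (suc m)) → M (m , x) → ∀ y → P y → Suffix y x → ⊥

FinOmega-mono : ∀ {M N : Dom → Set} → (∀ d → M d → N d) → FinOmega N → FinOmega M
FinOmega-mono M⊆N (k , P , fin , avoids) = k , P , fin , λ m x a → avoids m x (M⊆N (m , x) a)

FinOmega-∅ : FinOmega (λ _ → ⊥)
FinOmega-∅ = 0 , (λ _ → ⊤) , FinN-empty 0 {λ _ → ¬ ⊤} (λ _ ¬⊤ → ¬⊤ tt) , λ _ _ ()

FinOmega-raise : ExcludedMiddle 0ℓ → ∀ {k K M} {P : Vec ℕ (suc k) → Set} → k ≤′ K →
  FinN k (λ w → ¬ P w) → Avoids M P →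
  Σ (Vec ℕ (suc K) → Set) λ Q → FinN K (λ y → ¬ Q y) × Avoids M Q
FinOmega-raise em {K = K} {P = P} k≤K fin avoids = Q , FinN-mono K (λ _ → em⇒dne em) (FinN-suffixes k≤K _ fin) , avoidsQ
  where
  Q : Vec ℕ (suc K) → Set
  Q y = ¬ HasSuffixIn (λ w → ¬ P w) y
  avoidsQ : Avoids _ Q
  avoidsQ m x a y q y≼x = avoids m x a w (em⇒dne em λ ¬Pw → q (w , w≼y , ¬Pw)) (Suffix-trans w≼y y≼x)
    where
    w≼y = proj₂ (suffix y (s≤s (≤′⇒≤ k≤K)))
    w   = proj₁ (suffix y (s≤s (≤′⇒≤ k≤K)))

FinOmega-∪ : ExcludedMiddle 0ℓ → ∀ {M N : Dom → Set} → FinOmega M → FinOmega N → FinOmega (λ d → M d ⊎ N d)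
FinOmega-∪ em (k₁ , P₁ , fin₁ , avoids₁) (k₂ , P₂ , fin₂ , avoids₂) =
  K , (λ y → Q₁ y × Q₂ y) , FinN-mono K ¬×⇒⊎ (FinN-∪ em K finQ₁ finQ₂) , avoids
  where
  K = k₁ ⊔ k₂
  raised₁ = FinOmega-raise em (≤⇒≤′ (m≤m⊔n k₁ k₂)) fin₁ avoids₁
  raised₂ = FinOmega-raise em (≤⇒≤′ (m≤n⊔m k₁ k₂)) fin₂ avoids₂
  Q₁ = proj₁ raised₁
  Q₂ = proj₁ raised₂
  finQ₁ = proj₁ (proj₂ raised₁)
  finQ₂ = proj₁ (proj₂ raised₂)
  ¬×⇒⊎ : ∀ y → ¬ (Q₁ y × Q₂ y) → ¬ Q₁ y ⊎ ¬ Q₂ y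
  ¬×⇒⊎ y ¬q with em {Q₁ y}
  ... | yes q₁ = inj₂ λ q₂ → ¬q (q₁ , q₂)
  ... | no ¬q₁ = inj₁ ¬q₁
  avoids : Avoids _ (λ y → Q₁ y × Q₂ y)
  avoids m x (inj₁ a) y (q₁ , _) = proj₂ (proj₂ raised₁) m x a y q₁
  avoids m x (inj₂ b) y (_ , q₂) = proj₂ (proj₂ raised₂) m x b y q₂

FinOmega-covered : ExcludedMiddle 0ℓ → ∀ {A : Set₁} (B : A → Dom → Set) (L : List A) →
  All (λ a → FinOmega (B a)) L → ∀ {M} → (∀ d → M d → Any (λ a → B a d) L) → FinOmega M
FinOmega-covered em B []      []           cover = FinOmega-mono (λ d m → case cover d m of λ ()) FinOmega-∅
FinOmega-covered em B (a ∷ L) (fin ∷ fins) {M} cover =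
  FinOmega-mono split (FinOmega-∪ em fin (FinOmega-covered em B L fins {λ d → M d × ¬ B a d} rest))
  where
  split : ∀ d → M d → B a d ⊎ (M d × ¬ B a d)
  split d m with em {B a d}
  ... | yes b = inj₁ b
  ... | no ¬b = inj₂ (m , ¬b)
  rest : ∀ d → M d × ¬ B a d → Any (λ a → B a d) L
  rest d (m , ¬b) with cover d m
  ... | here b   = contradiction b ¬b
  ... | there bs = bs

Admissible : Family → ∀ {m} → Vec ℕ m → ℕ → Set
Admissible X x k = ∀ n (w : Vec ℕ (2 + n)) → Suffix w x → X n (init w) k × last w ≤ k

-- The s_n in the intersection hypothesis; a junk value when x is too short.
initOfSuffix : ∀ {m} → Vec ℕ m → (n : ℕ) → Vec ℕ (suc n)
initOfSuffix {m} x n with 2 + n ≤? m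
... | yes 2+n≤m = init (proj₁ (suffix x 2+n≤m))
... | no _      = replicate _ 0

initOfSuffix-correct : ∀ {m n} {x : Vec ℕ m} {w : Vec ℕ (2 + n)} → Suffix w x → initOfSuffix x n ≡ init w
initOfSuffix-correct {m} {n} {x} w≼x with 2 + n ≤? m
... | yes 2+n≤m = cong init (Suffix-unique (proj₂ (suffix x 2+n≤m)) w≼x)
... | no 2+n≰m  = contradiction (Suffix-length w≼x) 2+n≰m

admissible-infinite : (X : Family) → IntersectionsInfinite X → ∀ {m} (x : Vec ℕ (suc m)) → Infinite (Admissible X x)
admissible-infinite X intersections {m} x (N , bound) =
  intersections (upTo m) (initOfSuffix x) (N ⊔ suc (last x) , bound′)
  where
  bound′ : ∀ k → All (λ i → X i (initOfSuffix x i) k) (upTo m) → k < N ⊔ suc (last x)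
  bound′ k inAll with k <? last x
  ... | yes k<last = <-≤-trans (m<n⇒m<1+n k<last) (m≤n⊔m N (suc (last x)))
  ... | no k≮last  = <-≤-trans (bound k admissible) (m≤m⊔n N (suc (last x)))
    where
    admissible : Admissible X x k
    admissible n w w≼x =
      subst (λ s → X n s k) (initOfSuffix-correct w≼x) (All.lookup inAll (∈-upTo⁺ (≤-pred (Suffix-length w≼x)))) ,
      subst (_≤ k) (sym (Suffix-last w≼x)) (≮⇒≥ k≮last)

admissible-bijection : ExcludedMiddle 0ℓ → (X : Family) → IntersectionsInfinite X →
  Σ (Dom ⤖ ℕ) λ F → ∀ d → Admissible X (proj₂ d) (Bijection.to F d)
admissible-bijection em X intersections = G ⤖-∘ ↔⇒⤖ Dom↔ℕ⊎ℕ , admissible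
  where
  open Inverse LongVec↔ℕ
  interleaving = interleaving-bijection (λ t → Admissible X (proj₂ (from t)))
    (λ t → infinite⇒unbounded em (admissible-infinite X intersections (proj₂ (from t))))
  G = proj₁ interleaving
  admissible : ∀ d → Admissible X (proj₂ d) (Bijection.to G (Inverse.to Dom↔ℕ⊎ℕ d))
  admissible (zero , x)  n w w≼x = contradiction (Suffix-length w≼x) λ { (s≤s ()) }
  admissible (suc m , x) = subst (λ d → Admissible X (proj₂ d) (Bijection.to G (inj₂ (to (m , x)))))
    (strictlyInverseʳ (m , x)) (proj₂ interleaving (to (m , x)))

FinOmega-pullback-generator : ExcludedMiddle 0ℓ → (X : Family) (f : Dom → ℕ) →
  (∀ d → Admissible X (proj₂ d) (f d)) → ∀ n B → FinN2 X n B → FinOmega (λ d → B (f d))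
FinOmega-pullback-generator em X f admissible n B fin =
  suc n , (λ w → ¬ Hit w) , FinN-mono (suc n) {C = Hit} (λ _ → em⇒dne em) hits-small , avoids
  where
  Above : Vec ℕ (suc n) → ℕ → Set
  Above s i = Σ ℕ λ k → B k × X n s k × i ≤ k
  Hit : Vec ℕ (2 + n) → Set
  Hit w = Above (init w) (last w)
  infinite-fibre : ∀ s → ¬ FinSet (Above s) → Infinite (λ k → B k × X n s k)
  infinite-fibre s ¬fin (N , bound) = ¬fin (N , λ i (k , b , x , i≤k) → ≤-<-trans i≤k (bound k (b , x)))
  hits-small : FinN (suc n) Hit
  hits-small = FinN-lastFibres n Above (FinN-mono n infinite-fibre fin)
  avoids : Avoids (λ d → B (f d)) (λ w → ¬ Hit w)
  avoids m x b w ¬hit w≼x = ¬hit (f (m , x) , b , admissible (m , x) n w w≼x)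

FinOmega′-pullback : ExcludedMiddle 0ℓ → (X : Family) (f : Dom → ℕ) →
  (∀ d → Admissible X (proj₂ d) (f d)) → ∀ A → FinOmega' X A → FinOmega (λ d → A (f d))
FinOmega′-pullback em X f admissible A (L , generators , cover) =
  FinOmega-covered em (λ (n , B) d → B (f d)) L
    (All.map (λ {(n , B)} → FinOmega-pullback-generator em X f admissible n B) generators)
    (λ d → cover (f d))

corollary5p3 : ExcludedMiddle 0ℓ → (X : Family) →
    (∀ n → IsPartitionInf X n) → IntersectionsInfinite X →
    FinOmega' X ⊑ FinOmega
corollary5p3 em X _ intersections with admissible-bijection em X intersections
... | F , admissible = F , FinOmega′-pullback em X (Bijection.to F) admissible
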